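{- Let $L$ be a finite poset and $S$ a subpresheaf of $h_L$. Then $S$ has a b-index (i.e. there is $n$ such that for all $u:P\to L$, $v:Q\to L$, $u\in S_P$ and $u\sim_n v$ imply $v\in S_Q$) if and only if there is $m\ge 0$ such that for all $u:P\to L$, $v:Q\to L$, $u\in S_P$ and $v\le_m u$ imply $v\in S_Q$. Thus $\mathcal S(h_L)$ is equivalently the set of subpresheaves of $h_L$ satisfying the latter condition for some $m$.
   Context: $\mathbf P_0$: category of finite posets with a greatest element (root $\rho(P)$) and open (p-)morphisms $h:Q\to P$ (order-preserving, and whenever $p'\le h(q)$ there is $q'\le q$ with $h(q')=p'$). $\downarrow p=\{p'\le p\}$. For a finite poset $L$, $h_L$ is the presheaf on $\mathbf P_0$ with $h_L(P)$ the order-preserving maps $u:P\to L$ and restriction $u\mapsto u\circ h$; $u_p$ is the restriction of $u$ to $\downarrow p$. Relations on $L$-evaluations $u:P\to L$, $v:Q\to L$: $u\sim_0 v$ iff $u(\rho(P))=v(\rho(Q))$; $u\sim_{n+1}v$ iff every $p\in P$ has $q\in Q$ with $u_p\sim_n v_q$ and every $q\in Q$ has $p\in P$ with $u_p\sim_n v_q$. $v\le_0 u$ iff $v(\rho(Q))\le u(\rho(P))$; $v\le_{n+1}u$ iff for every $q\in Q$ there is $p\in P$ with $v_q\sim_n u_p$. $\mathcal S(h_L)$ is the set of subpresheaves of $h_L$ having a b-index in the sense of the first condition. -}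

module Defs where

open import Data.Nat using (ℕ; zero; suc)
open import Data.Fin using (Fin)
open import Data.Product using (Σ; _×_; ∃)
open import Relation.Binary.PropositionalEquality using (_≡_)
open import Relation.Nullary using (Dec)
open import Function.Bundles using (_⇔_)

record FinPoset : Set₁ where
  field
    size    : ℕ
    _≼_     : Fin size → Fin size → Set
    ≼-dec   : ∀ x y → Dec (x ≼ y)
    ≼-refl  : ∀ x → x ≼ x
    ≼-trans : ∀ {x y z} → x ≼ y → y ≼ z → x ≼ z
    ≼-antisym : ∀ {x y} → x ≼ y → y ≼ x → x ≡ y

record RootedPoset : Set₁ where
  field
    poset  : FinPoset
  open FinPoset poset public
  field
    ρ      : Fin size
    ρ-top  : ∀ x → x ≼ ρ

open RootedPoset

Map : RootedPoset → FinPoset → Set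
Map P L = Fin (size P) → Fin (FinPoset.size L)

-- Order preservation (u is an element of h_L(P) iff Monotone P L u).
Monotone : (P : RootedPoset) (L : FinPoset) → Map P L → Set
Monotone P L u = ∀ {x y} → _≼_ P x y → FinPoset._≼_ L (u x) (u y)

record PMorphism (Q P : RootedPoset) : Set where
  field
    fun  : Fin (size Q) → Fin (size P)
    mono : ∀ {x y} → _≼_ Q x y → _≼_ P (fun x) (fun y)
    open-cond : ∀ q p' → _≼_ P p' (fun q) →
                Σ (Fin (size Q)) λ q' → _≼_ Q q' q × fun q' ≡ p'

-- Subpresheaves of h_L: for each P a subset S_P of h_L(P) (order-preserving
-- maps P → L), taken extensionally, closed under restriction u ↦ u ∘ h
-- along p-morphisms h : Q → P.
record Subpresheaf (L : FinPoset) : Set₁ where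
  field
    S       : (P : RootedPoset) → Map P L → Set
    S⊆h     : ∀ {P u} → S P u → Monotone P L u
    S-ext   : ∀ {P u u'} → (∀ x → u x ≡ u' x) → S P u → S P u'
    S-restr : ∀ {Q P} (h : PMorphism Q P) {u} → S P u →
              S Q (λ x → u (PMorphism.fun h x))

-- u_p ∼ₙ v_q, where u_p is the restriction of u to ↓p (a rooted poset with
-- root p); (u_p)_{p'} = u_{p'} for p' ≤ p, so the recursion unfolds as below.
Sim : (L : FinPoset) → ℕ →
      (P : RootedPoset) → Map P L → Fin (size P) →
      (Q : RootedPoset) → Map Q L → Fin (size Q) → Set
Sim L zero    P u p Q v q = u p ≡ v q
Sim L (suc n) P u p Q v q =
  (∀ p' → _≼_ P p' p → Σ (Fin (size Q)) λ q' → _≼_ Q q' q × Sim L n P u p' Q v q')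
  × (∀ q' → _≼_ Q q' q → Σ (Fin (size P)) λ p' → _≼_ P p' p × Sim L n P u p' Q v q')

-- u ∼ₙ v  (for u : P → L, v : Q → L): u = u_{ρ(P)}, v = v_{ρ(Q)}.
_∼[_]_ : {L : FinPoset} {P Q : RootedPoset} → Map P L → ℕ → Map Q L → Set
_∼[_]_ {L} {P} {Q} u n v = Sim L n P u (ρ P) Q v (ρ Q)

Le : (L : FinPoset) → ℕ → (Q : RootedPoset) → Map Q L → (P : RootedPoset) → Map P L → Set
Le L zero    Q v P u = FinPoset._≼_ L (v (ρ Q)) (u (ρ P))
Le L (suc n) Q v P u = ∀ q → Σ (Fin (size P)) λ p → Sim L n Q v q P u p

HasBIndex : (L : FinPoset) → Subpresheaf L → Set₁
HasBIndex L S = ∃ λ (n : ℕ) →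
  ∀ (P Q : RootedPoset) (u : Map P L) (v : Map Q L) →
  Monotone P L u → Monotone Q L v →
  Subpresheaf.S S P u → _∼[_]_ {L} {P} {Q} u n v → Subpresheaf.S S Q v

HasLeIndex : (L : FinPoset) → Subpresheaf L → Set₁
HasLeIndex L S = ∃ λ (m : ℕ) →
  ∀ (P Q : RootedPoset) (u : Map P L) (v : Map Q L) →
  Monotone P L u → Monotone Q L v →
  Subpresheaf.S S P u → Le L m Q v P u → Subpresheaf.S S Q v

-- Since u ∼ₙ v implies v ≤ₙ u, an ≤-index is a b-index. Conversely, given v ≤ₙ u,
-- put P and Q side by side under a new root and glue u and v into an evaluation w
-- with value u(ρ P) at the root. Every point of Q is then matched by a point of P,
-- so u ∼ₙ w and w ∈ S by the b-index; and Q includes into the glued poset as an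
-- open down-set, along which w restricts to v ∈ S.
module Submission where

open import Defs
open import Data.Nat using (zero; suc; _+_)
open import Data.Fin using (Fin; zero; suc; splitAt; _↑ˡ_; _↑ʳ_)
open import Data.Fin.Properties using (splitAt-↑ˡ; splitAt-↑ʳ; splitAt⁻¹-↑ˡ; splitAt⁻¹-↑ʳ; +↔⊎)
open import Data.Sum using (_⊎_; inj₁; inj₂; [_,_]′)
open import Data.Sum.Relation.Binary.Pointwise
  using (Pointwise; inj₁; inj₂; ⊎-refl; ⊎-transitive; ⊎-antisymmetric; ⊎-decidable; Pointwise-≡⇒≡)
open import Data.Product using (Σ; _×_; _,_)
open import Data.Unit using (⊤; tt)
open import Data.Empty using (⊥)
open import Relation.Nullary using (Dec; yes; no)
open import Relation.Binary.PropositionalEquality using (_≡_; refl; sym; trans; cong; subst; subst₂)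
open import Function.Bundles using (_⇔_; mk⇔; Injection)
open import Function.Properties.Inverse using (Inverse⇒Injection)

module _ {a b r s} {A : Set a} {B : Set b} {R : A → A → Set r} {S : B → B → Set s} where

  Pointwise-below-inj₁ : ∀ {x : A ⊎ B} {y} → Pointwise R S x (inj₁ y) →
                         Σ A λ y' → R y' y × x ≡ inj₁ y'
  Pointwise-below-inj₁ (inj₁ r) = _ , r , refl

  Pointwise-below-inj₂ : ∀ {x : A ⊎ B} {y} → Pointwise R S x (inj₂ y) →
                         Σ B λ y' → S y' y × x ≡ inj₂ y'
  Pointwise-below-inj₂ (inj₂ s) = _ , s , refl

_⊎ᴾ_ : FinPoset → FinPoset → FinPoset
A ⊎ᴾ B = record
  { size      = A.size + B.size
  ; _≼_       = λ x y → Pointwise A._≼_ B._≼_ (splitAt A.size x) (splitAt A.size y)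
  ; ≼-dec     = λ x y → ⊎-decidable A.≼-dec B.≼-dec (splitAt A.size x) (splitAt A.size y)
  ; ≼-refl    = λ _ → ⊎-refl (A.≼-refl _) (B.≼-refl _)
  ; ≼-trans   = ⊎-transitive A.≼-trans B.≼-trans
  ; ≼-antisym = λ x≼y y≼x → Injection.injective (Inverse⇒Injection +↔⊎)
                  (Pointwise-≡⇒≡ (⊎-antisymmetric A.≼-antisym B.≼-antisym x≼y y≼x))
  }
  where
  module A = FinPoset A
  module B = FinPoset B

module _ (A B : FinPoset) where
  private
    module A = FinPoset A
    module B = FinPoset B
    module AB = FinPoset (A ⊎ᴾ B)

  ↑ˡ-mono : ∀ {x y} → x A.≼ y → (x ↑ˡ B.size) AB.≼ (y ↑ˡ B.size)
  ↑ˡ-mono {x} {y} x≼y =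
    subst₂ (Pointwise A._≼_ B._≼_) (sym (splitAt-↑ˡ A.size x B.size)) (sym (splitAt-↑ˡ A.size y B.size))
      (inj₁ x≼y)

  ↑ʳ-mono : ∀ {x y} → x B.≼ y → (A.size ↑ʳ x) AB.≼ (A.size ↑ʳ y)
  ↑ʳ-mono {x} {y} x≼y =
    subst₂ (Pointwise A._≼_ B._≼_) (sym (splitAt-↑ʳ A.size B.size x)) (sym (splitAt-↑ʳ A.size B.size y))
      (inj₂ x≼y)

  ↑ˡ-downward : ∀ {z y} → z AB.≼ (y ↑ˡ B.size) → Σ (Fin A.size) λ x → x A.≼ y × x ↑ˡ B.size ≡ z
  ↑ˡ-downward {z} {y} z≼y
    with x , x≼y , eq ← Pointwise-below-inj₁ (subst (Pointwise A._≼_ B._≼_ (splitAt A.size z))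
                                                     (splitAt-↑ˡ A.size y B.size) z≼y)
    = x , x≼y , splitAt⁻¹-↑ˡ eq

  ↑ʳ-downward : ∀ {z y} → z AB.≼ (A.size ↑ʳ y) → Σ (Fin B.size) λ x → x B.≼ y × A.size ↑ʳ x ≡ z
  ↑ʳ-downward {z} {y} z≼y
    with x , x≼y , eq ← Pointwise-below-inj₂ (subst (Pointwise A._≼_ B._≼_ (splitAt A.size z))
                                                     (splitAt-↑ʳ A.size B.size y) z≼y)
    = x , x≼y , splitAt⁻¹-↑ʳ eq

module _ (A : FinPoset) where
  open FinPoset A

  _≤⊤_ : Fin (suc size) → Fin (suc size) → Set
  _     ≤⊤ zero  = ⊤
  zero  ≤⊤ suc _ = ⊥
  suc x ≤⊤ suc y = x ≼ y

  ≤⊤-dec : ∀ x y → Dec (x ≤⊤ y)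
  ≤⊤-dec _       zero    = yes tt
  ≤⊤-dec zero    (suc _) = no λ ()
  ≤⊤-dec (suc x) (suc y) = ≼-dec x y

  ≤⊤-refl : ∀ x → x ≤⊤ x
  ≤⊤-refl zero    = tt
  ≤⊤-refl (suc x) = ≼-refl x

  ≤⊤-trans : ∀ {x y z} → x ≤⊤ y → y ≤⊤ z → x ≤⊤ z
  ≤⊤-trans {z = zero}                        _   _   = tt
  ≤⊤-trans {y = zero}    {z = suc _}         _   ()
  ≤⊤-trans {zero}        {suc _} {suc _}     ()  _
  ≤⊤-trans {suc _}       {suc _} {suc _}     x≼y y≼z = ≼-trans x≼y y≼z

  ≤⊤-antisym : ∀ {x y} → x ≤⊤ y → y ≤⊤ x → x ≡ y
  ≤⊤-antisym {zero}  {zero}  _   _   = refl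
  ≤⊤-antisym {zero}  {suc _} ()  _
  ≤⊤-antisym {suc _} {zero}  _   ()
  ≤⊤-antisym {suc _} {suc _} x≼y y≼x = cong suc (≼-antisym x≼y y≼x)

  withTop : RootedPoset
  withTop = record
    { poset = record
      { size = suc size ; _≼_ = _≤⊤_ ; ≼-dec = ≤⊤-dec ; ≼-refl = ≤⊤-refl
      ; ≼-trans = λ {x y z} → ≤⊤-trans {x} {y} {z} ; ≼-antisym = λ {x y} → ≤⊤-antisym {x} {y} }
    ; ρ     = zero
    ; ρ-top = λ _ → tt
    }

open RootedPoset
open PMorphism

_⊕_ : RootedPoset → RootedPoset → RootedPoset
P ⊕ Q = withTop (poset P ⊎ᴾ poset Q)

module _ (P Q : RootedPoset) where

  ι₁ : PMorphism P (P ⊕ Q)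
  ι₁ = record
    { fun       = λ p → suc (p ↑ˡ size Q)
    ; mono      = ↑ˡ-mono (poset P) (poset Q)
    ; open-cond = λ { _ zero () ; _ (suc z) z≼p → let (p' , p'≼p , eq) = ↑ˡ-downward (poset P) (poset Q) z≼p
                                                 in p' , p'≼p , cong suc eq }
    }

  ι₂ : PMorphism Q (P ⊕ Q)
  ι₂ = record
    { fun       = λ q → suc (size P ↑ʳ q)
    ; mono      = ↑ʳ-mono (poset P) (poset Q)
    ; open-cond = λ { _ zero () ; _ (suc z) z≼q → let (q' , q'≼q , eq) = ↑ʳ-downward (poset P) (poset Q) z≼q
                                                 in q' , q'≼q , cong suc eq }
    }

module _ (L : FinPoset) where
  open FinPoset L using () renaming (_≼_ to _⊑_; ≼-refl to ⊑-refl; ≼-trans to ⊑-trans; ≼-antisym to ⊑-antisym)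

  Sim-sym : ∀ k {P u p Q v q} → Sim L k P u p Q v q → Sim L k Q v q P u p
  Sim-sym zero    e               = sym e
  Sim-sym (suc k) (forth , back) =
    (λ q' q'≼q → let (p' , p'≼p , s) = back q' q'≼q in p' , p'≼p , Sim-sym k s) ,
    (λ p' p'≼p → let (q' , q'≼q , s) = forth p' p'≼p in q' , q'≼q , Sim-sym k s)

  Sim-trans : ∀ k {P u p Q v q R w r} → Sim L k P u p Q v q → Sim L k Q v q R w r → Sim L k P u p R w r
  Sim-trans zero    e₁ e₂ = trans e₁ e₂
  Sim-trans (suc k) (forth₁ , back₁) (forth₂ , back₂) =
    (λ p' p'≼p → let (q' , q'≼q , s₁) = forth₁ p' p'≼p ; (r' , r'≼r , s₂) = forth₂ q' q'≼q
                 in r' , r'≼r , Sim-trans k s₁ s₂) ,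
    (λ r' r'≼r → let (q' , q'≼q , s₂) = back₂ r' r'≼r ; (p' , p'≼p , s₁) = back₁ q' q'≼q
                 in p' , p'≼p , Sim-trans k s₁ s₂)

  Sim⇒⊑ : ∀ k {Q v q P u p} → Monotone P L u → Sim L k Q v q P u p → v q ⊑ u p
  Sim⇒⊑ zero    _  e         = subst (_ ⊑_) e (⊑-refl _)
  Sim⇒⊑ (suc k) {Q} {q = q} mu (forth , _) =
    let (_ , p'≼p , s) = forth q (≼-refl Q q) in ⊑-trans (Sim⇒⊑ k mu s) (mu p'≼p)

  Sim-suc⇒Sim : ∀ k {Q v q P u p} → Monotone Q L v → Monotone P L u →
                Sim L (suc k) Q v q P u p → Sim L k Q v q P u p
  Sim-suc⇒Sim zero {Q} {P = P} mv mu s =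
    ⊑-antisym (Sim⇒⊑ 1 {Q} {P = P} mu s) (Sim⇒⊑ 1 {P} {P = Q} mv (Sim-sym 1 {Q} {Q = P} s))
  Sim-suc⇒Sim (suc k) mv mu (forth , back) =
    (λ q' q'≼q → let (p' , p'≼p , s) = forth q' q'≼q in p' , p'≼p , Sim-suc⇒Sim k mv mu s) ,
    (λ p' p'≼p → let (q' , q'≼q , s) = back p' p'≼p in q' , q'≼q , Sim-suc⇒Sim k mv mu s)

  Sim-pmorphism : ∀ {Q P} (h : PMorphism Q P) {v : Map Q L} {u : Map P L} →
                  (∀ q → u (fun h q) ≡ v q) → ∀ k q → Sim L k Q v q P u (fun h q)
  Sim-pmorphism h u∘h≗v zero    q = sym (u∘h≗v q)
  Sim-pmorphism {Q} {P} h {v} {u} u∘h≗v (suc k) q =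
    (λ q' q'≼q → fun h q' , mono h q'≼q , Sim-pmorphism h u∘h≗v k q') ,
    (λ p' p'≼hq → let (q' , q'≼q , hq'≡p') = open-cond h q p' p'≼hq
                  in q' , q'≼q , subst (Sim L k Q v q' P u) hq'≡p' (Sim-pmorphism h u∘h≗v k q'))

  ∼⇒Le : ∀ n {P Q} {u : Map P L} {v : Map Q L} → _∼[_]_ {L} {P} {Q} u n v → Le L n Q v P u
  ∼⇒Le zero    {P} {u = u} e = subst (_⊑ u (ρ P)) e (⊑-refl _)
  ∼⇒Le (suc k) {Q = Q} (_ , back) q =
    let (p , _ , s) = back q (ρ-top Q q) in p , Sim-sym k s

  module Gluing (P Q : RootedPoset) (u : Map P L) (v : Map Q L)
                (mu : Monotone P L u) (mv : Monotone Q L v) where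

    Le⇒bounded : ∀ n → Le L n Q v P u → ∀ q → v q ⊑ u (ρ P)
    Le⇒bounded zero    v≤u q = ⊑-trans (mv (ρ-top Q q)) v≤u
    Le⇒bounded (suc k) v≤u q = let (p , s) = v≤u q in ⊑-trans (Sim⇒⊑ k mu s) (mu (ρ-top P p))

    Le-suc⇒Le : ∀ k → Le L (suc k) Q v P u → Le L k Q v P u
    Le-suc⇒Le zero    v≤u   = Le⇒bounded 1 v≤u (ρ Q)
    Le-suc⇒Le (suc k) v≤u q = let (p , s) = v≤u q in p , Sim-suc⇒Sim k mv mu s

    glue : Map (P ⊕ Q) L
    glue zero    = u (ρ P)
    glue (suc i) = [ u , v ]′ (splitAt (size P) i)

    glue-ι₁ : ∀ p → glue (fun (ι₁ P Q) p) ≡ u p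
    glue-ι₁ p = cong [ u , v ]′ (splitAt-↑ˡ (size P) p (size Q))

    glue-ι₂ : ∀ q → glue (fun (ι₂ P Q) q) ≡ v q
    glue-ι₂ q = cong [ u , v ]′ (splitAt-↑ʳ (size P) (size Q) q)

    glue-mono : (∀ q → v q ⊑ u (ρ P)) → Monotone (P ⊕ Q) L glue
    glue-mono bounded {x} {zero}      _   = below-root x
      where
      below-root : ∀ x → glue x ⊑ u (ρ P)
      below-root zero    = ⊑-refl _
      below-root (suc i) with splitAt (size P) i
      ... | inj₁ p = mu (ρ-top P p)
      ... | inj₂ q = bounded q
    glue-mono bounded {zero}  {suc _} ()
    glue-mono bounded {suc _} {suc _} x≼y = copair-mono x≼y
      where
      copair-mono : ∀ {x y} → Pointwise (_≼_ P) (_≼_ Q) x y → [ u , v ]′ x ⊑ [ u , v ]′ y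
      copair-mono (inj₁ p≼p') = mu p≼p'
      copair-mono (inj₂ q≼q') = mv q≼q'

    Le⇒∼glue : ∀ n → Le L n Q v P u → _∼[_]_ {L} {P} {P ⊕ Q} u n glue
    Le⇒∼glue zero    _   = refl
    Le⇒∼glue (suc k) v≤u = forth , back
      where
      forth : ∀ p → _≼_ P p (ρ P) → Σ (Fin (size (P ⊕ Q))) λ x → _≼_ (P ⊕ Q) x (ρ (P ⊕ Q)) × Sim L k P u p (P ⊕ Q) glue x
      forth p _ = fun (ι₁ P Q) p , tt , Sim-pmorphism (ι₁ P Q) glue-ι₁ k p

      back : ∀ x → _≼_ (P ⊕ Q) x (ρ (P ⊕ Q)) → Σ (Fin (size P)) λ p → _≼_ P p (ρ P) × Sim L k P u p (P ⊕ Q) glue x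
      back zero    _ = ρ P , ≼-refl P (ρ P) , Le⇒∼glue k (Le-suc⇒Le k v≤u)
      back (suc i) _ with splitAt (size P) i in eq
      ... | inj₁ p = p , ρ-top P p ,
        subst (Sim L k P u p (P ⊕ Q) glue) (cong suc (splitAt⁻¹-↑ˡ eq))
              (Sim-pmorphism (ι₁ P Q) glue-ι₁ k p)
      ... | inj₂ q = let (p , v≈u) = v≤u q in p , ρ-top P p ,
        subst (Sim L k P u p (P ⊕ Q) glue) (cong suc (splitAt⁻¹-↑ʳ eq))
              (Sim-trans k (Sim-sym k v≈u) (Sim-pmorphism (ι₂ P Q) glue-ι₂ k q))

module _ (L : FinPoset) (S : Subpresheaf L) where
  open Subpresheaf S using (S-ext; S-restr)

  HasBIndex⇒HasLeIndex : HasBIndex L S → HasLeIndex L S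
  HasBIndex⇒HasLeIndex (n , closed) = n , λ P Q u v mu mv u∈S v≤u →
    let open Gluing L P Q u v mu mv
        glue∈S = closed P (P ⊕ Q) u glue mu (λ {x y} → glue-mono (Le⇒bounded n v≤u) {x} {y}) u∈S
                        (Le⇒∼glue n v≤u)
    in S-ext glue-ι₂ (S-restr (ι₂ P Q) glue∈S)

  HasLeIndex⇒HasBIndex : HasLeIndex L S → HasBIndex L S
  HasLeIndex⇒HasBIndex (m , closed) = m , λ P Q u v mu mv u∈S u∼v →
    closed P Q u v mu mv u∈S (∼⇒Le L m u∼v)

mainTheorem4 : (L : FinPoset) (S : Subpresheaf L) → HasBIndex L S ⇔ HasLeIndex L S
mainTheorem4 L S = mk⇔ (HasBIndex⇒HasLeIndex L S) (HasLeIndex⇒HasBIndex L S)
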